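{- Let $q$ be a prime power, $E=\mathbb{F}_q^n$, and let $F_1,\dots,F_t$ be a shelling of a shellable $q$-complex $\Delta$ on $E$. For $i=0,1,\dots,t$ let $\Delta_i=\langle F_1,\dots,F_i\rangle$ (so $\Delta_0=\emptyset$). Then for every $1\le i\le t$, $$\Delta_i=I_i\cup\Delta_{i-1}\quad\text{and}\quad I_i\cap\Delta_{i-1}=\emptyset.$$ Consequently $\Delta$ is the disjoint union $\Delta=\coprod_{i=1}^t I_i$.
   Context: A $q$-complex on $E$ is a set of subspaces of $E$ closed under taking subspaces; facets are its inclusion-maximal elements; it is pure if all facets have equal dimension. For a set $\mathcal{A}$ of subspaces, $\langle\mathcal{A}\rangle$ is the set of subspaces contained in some member of $\mathcal{A}$ (and $\langle\emptyset\rangle=\emptyset$). A shelling is a linear order $F_1,\dots,F_t$ of the facets of a pure $q$-complex such that for each $j\ge2$, $\langle F_j\rangle\cap\langle F_1,\dots,F_{j-1}\rangle$ is generated by a nonempty set of subspaces of $F_j$ of dimension $\dim F_j-1$; shellable means pure and admitting a shelling. For $1\le j<i\le t$ define $\mathcal{R}_{i,j}=\{x\in F_i:\langle x\rangle\oplus(F_i\cap F_j)=F_i\}$, and for $1\le i\le t$ define $I_i=\{A\in\langle F_i\rangle: A\cap\mathcal{R}_{i,j}\ne\emptyset\text{ whenever }1\le j<i\text{ and }\mathcal{R}_{i,j}\ne\emptyset\}$. -}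

module Defs where

open import Level using (0ℓ; Lift)
open import Algebra.Bundles using (CommutativeRing)
open import Data.Nat using (ℕ; zero; suc; _<_)
open import Data.Fin using (Fin; toℕ)
open import Data.Product using (Σ; ∃; _×_; _,_)
open import Data.Sum using (_⊎_)
open import Relation.Nullary using (¬_; Dec)
open import Relation.Binary.PropositionalEquality using (_≡_)
open import Function.Bundles using (_⇔_)

-- A finite field: a commutative ring with 0 ≉ 1 in which every nonzero
-- element is invertible, with decidable equality and exactly q elements
-- (enumerated up to ≈ by an injective and surjective map Fin q → K).
-- (Its size q is then automatically a prime power.)
record FiniteField : Set₁ where
  field
    cring : CommutativeRing 0ℓ 0ℓ
  open CommutativeRing cring public
  field
    0≉1     : ¬ (0# ≈ 1#)
    inverse : ∀ a → ¬ (a ≈ 0#) → ∃ λ b → a * b ≈ 1#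
    _≟_     : ∀ a b → Dec (a ≈ b)
    q       : ℕ
    enum    : Fin q → Carrier
    enum-inj  : ∀ i j → enum i ≈ enum j → i ≡ j
    enum-surj : ∀ a → ∃ λ i → enum i ≈ a

module Space (K : FiniteField) (n : ℕ) where
  open FiniteField K

  V : Set
  V = Fin n → Carrier

  _≈ᵥ_ : V → V → Set
  u ≈ᵥ v = ∀ k → u k ≈ v k

  0ᵥ : V
  0ᵥ _ = 0#

  _+ᵥ_ : V → V → V
  (u +ᵥ v) k = u k + v k

  _·ᵥ_ : Carrier → V → V
  (a ·ᵥ v) k = a * v k

  lincomb : ∀ {d} → (Fin d → Carrier) → (Fin d → V) → V
  lincomb {zero}  c b = 0ᵥ
  lincomb {suc d} c b = (c Fin.zero ·ᵥ b Fin.zero) +ᵥ lincomb (λ k → c (Fin.suc k)) (λ k → b (Fin.suc k))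
    where import Data.Fin as Fin

  -- A subspace of E (with decidable membership; every subspace of the
  -- finite space E is finite, so this is no restriction).
  record Subspace : Set₁ where
    field
      mem      : V → Set
      mem?     : ∀ v → Dec (mem v)
      mem-resp : ∀ {u v} → u ≈ᵥ v → mem u → mem v
      mem-0    : mem 0ᵥ
      mem-+    : ∀ {u v} → mem u → mem v → mem (u +ᵥ v)
      mem-·    : ∀ a {v} → mem v → mem (a ·ᵥ v)
  open Subspace public

  _⊆_ : Subspace → Subspace → Set
  A ⊆ B = ∀ v → mem A v → mem B v

  HasDim : Subspace → ℕ → Set
  HasDim A d = Σ (Fin d → V) λ b →
      (∀ k → mem A (b k))
    × (∀ c → lincomb c b ≈ᵥ 0ᵥ → ∀ k → c k ≈ 0#)
    × (∀ v → mem A v → ∃ λ c → v ≈ᵥ lincomb c b)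

  SubspSet : Set₂
  SubspSet = Subspace → Set₁

  ⟨_⟩ : SubspSet → SubspSet
  ⟨ 𝒜 ⟩ A = ∃ λ B → 𝒜 B × A ⊆ B

  IsQComplex : SubspSet → Set₁
  IsQComplex Δ = ∀ A B → A ⊆ B → Δ B → Δ A

  IsFacet : SubspSet → Subspace → Set₁
  IsFacet Δ F = Δ F × (∀ G → Δ G → F ⊆ G → G ⊆ F)

  IsPure : SubspSet → Set₁
  IsPure Δ = ∃ λ d → ∀ F → IsFacet Δ F → HasDim F d

  -- F : Fin t → Subspace is a linear order F₀,…,F_{t-1} of the facets of Δ
  -- (0-based indexing; paper's F_{k+1} is F k)
  IsFacetOrder : SubspSet → ∀ {t} → (Fin t → Subspace) → Set₁
  IsFacetOrder Δ {t} F =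
      (∀ k → IsFacet Δ (F k))
    × (∀ G → IsFacet Δ G → ∃ λ k → (G ⊆ F k × F k ⊆ G))
    × (∀ k l → F k ⊆ F l → F l ⊆ F k → k ≡ l)

  module _ {t : ℕ} (F : Fin t → Subspace) where

    -- Δ_i = ⟨F_1,…,F_i⟩ (paper indexing), i.e. generated by F k with toℕ k < i
    Δ[_] : ℕ → SubspSet
    Δ[ i ] A = Lift _ (∃ λ (j : Fin t) → toℕ j < i × A ⊆ F j)

    ShellingStep : Fin t → Set₂
    ShellingStep k = ∃ λ (𝒢 : SubspSet) →
        (∃ λ G → 𝒢 G)
      × (∃ λ d → HasDim (F k) (suc d) × (∀ G → 𝒢 G → G ⊆ F k × HasDim G d))
      × (∀ A → (⟨ 𝒢 ⟩ A → (A ⊆ F k × Δ[ toℕ k ] A))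
             × ((A ⊆ F k × Δ[ toℕ k ] A) → ⟨ 𝒢 ⟩ A))

    IsShelling : Set₂
    IsShelling = ∀ k → 0 < toℕ k → ShellingStep k

    -- x ∈ R_{i,j} :  x ∈ F_i and ⟨x⟩ ⊕ (F_i ∩ F_j) = F_i
    R : Fin t → Fin t → V → Set
    R i j x =
        mem (F i) x
      × (∀ v → (mem (F i) v → ∃ λ a → ∃ λ w → (mem (F i) w × mem (F j) w) × v ≈ᵥ ((a ·ᵥ x) +ᵥ w))
             × ((∃ λ a → ∃ λ w → (mem (F i) w × mem (F j) w) × v ≈ᵥ ((a ·ᵥ x) +ᵥ w)) → mem (F i) v))
      × (∀ a → (mem (F i) (a ·ᵥ x) × mem (F j) (a ·ᵥ x)) → (a ·ᵥ x) ≈ᵥ 0ᵥ)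

    I : Fin t → SubspSet
    I i A = Lift _ (A ⊆ F i
      × (∀ j → toℕ j < toℕ i → (∃ λ x → R i j x) → ∃ λ x → mem A x × R i j x))

-- Adding F_i to Δ_{i-1} creates exactly the faces A ⊆ F_i that lie in no earlier F_j, and such
-- an A meets every nonempty R_{i,j}: any x ∈ A ∖ F_j spans a complement of F_i ∩ F_j in F_i,
-- because the existing witness y of R_{i,j} decomposes x with a nonzero y-coefficient.
-- Conversely a face of F_i already in Δ_{i-1} lies, by the shelling property, in a
-- codimension-one subspace G ⊆ F_i ∩ F_k with k < i; every x ∈ F_i ∖ F_k then lies in R_{i,k}
-- (F_i = ⟨x⟩ + G by counting dimensions), so a face in I_i would contain a vector of R_{i,k}
-- inside F_k, forcing F_i ⊆ F_k.  The partition of Δ follows since, in a finite space, every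
-- face lies below a facet.

module Submission where

open import Defs
open import Data.Nat using (ℕ; suc)
open import Data.Fin using (Fin; toℕ)
open import Data.Product using (∃; _×_)
open import Data.Sum using (_⊎_)
open import Relation.Nullary using (¬_; Dec)
open import Relation.Binary.PropositionalEquality using (_≡_)
open import Function.Bundles using (_⇔_)

open import Level using (0ℓ; lift; lower)
open import Data.Nat using (zero; _<_; _≤_; _∸_; _<?_; z≤n; s≤s)
import Data.Nat.Properties as ℕ
open import Data.Nat.Induction using (<-wellFounded)
import Data.Fin as Fin
import Data.Fin.Properties as FinP
open import Data.Vec.Functional using (tail)
import Data.Vec.Functional as Vector
open import Data.Vec.Functional.Relation.Binary.Pointwise using (Pointwise)
import Data.Vec.Functional.Relation.Binary.Pointwise.Properties as Pointwise
open import Data.List using (List; [_]; map; concat; allFin; filter; length)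
open import Data.List.Properties using (length-filter)
open import Data.List.Relation.Unary.Any using (Any; here; there; any?; satisfied)
import Data.List.Relation.Unary.Any as Any
import Data.List.Relation.Unary.Any.Properties as Any
import Data.List.Membership.Setoid as Membership
import Data.List.Relation.Binary.Sublist.Propositional.Properties as Sublist
open import Data.List.Relation.Binary.Sublist.Propositional using (⊆-refl)
open import Data.Product using (_,_; proj₁; proj₂; uncurry)
open import Data.Sum using (inj₁; inj₂)
open import Data.Empty using (⊥; ⊥-elim)
open import Relation.Nullary using (yes; no; ¬?; contradiction)
open import Relation.Nullary.Decidable using (map′; decidable-stable; _×-dec_)
open import Relation.Unary using (Pred; Decidable)
open import Relation.Binary.Bundles using (Setoid)
import Relation.Binary.PropositionalEquality as ≡
open import Relation.Binary.Definitions using (tri<; tri≈; tri>)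
import Relation.Binary.Construct.On as On
open import Induction.WellFounded using (Acc; acc)
open import Function using (_∘_; _on_)
open import Function.Bundles using (mk⇔; Equivalence)

module _ {A : Set} {P Q : Pred A 0ℓ} (P? : Decidable P) (Q? : Decidable Q) (P⇒Q : ∀ {x} → P x → Q x) where
  open Data.List using (_∷_)

  length-filter-mono : ∀ xs → length (filter P? xs) ≤ length (filter Q? xs)
  length-filter-mono xs =
    Sublist.length-mono-≤ (Sublist.filter⁺ P? Q? (λ { ≡.refl → P⇒Q }) (⊆-refl {x = xs}))

  length-filter-< : ∀ {xs} → Any (λ x → Q x × ¬ P x) xs → length (filter P? xs) < length (filter Q? xs)
  length-filter-< {x ∷ xs} (here (qx , ¬px)) with P? x | Q? x
  ... | yes px | _      = contradiction px ¬px
  ... | no _   | yes _  = s≤s (length-filter-mono xs)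
  ... | no _   | no ¬qx = contradiction qx ¬qx
  length-filter-< {x ∷ xs} (there any) with P? x | Q? x
  ... | yes px | yes _  = s≤s (length-filter-< any)
  ... | yes px | no ¬qx = contradiction (P⇒Q px) ¬qx
  ... | no _   | yes _  = ℕ.m<n⇒m<1+n (length-filter-< any)
  ... | no _   | no _   = length-filter-< any

module LinearAlgebra (K : FiniteField) (n : ℕ) where
  open FiniteField K
  open Space K n
  open Vector using (_∷_)
  open import Algebra.Solver.Ring.NaturalCoefficients.Default commutativeSemiring
    using (solve; _:+_; _:*_; _:=_)

  ≈ᵥ-setoid : Setoid 0ℓ 0ℓ
  ≈ᵥ-setoid = Pointwise.setoid setoid n

  module ≈ᵥ = Setoid ≈ᵥ-setoid

  *-annihilatedˡ : ∀ {a} x → a ≈ 0# → a * x ≈ 0#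
  *-annihilatedˡ x a≈0 = trans (*-cong a≈0 refl) (zeroˡ x)

  annihilated-+ : ∀ {a} x y → a ≈ 0# → a * x + y ≈ y
  annihilated-+ x y a≈0 = trans (+-cong (*-annihilatedˡ x a≈0) refl) (+-identityˡ y)

  zero-or-invertible : ∀ a → a ≈ 0# ⊎ ∃ λ α → a * α ≈ 1#
  zero-or-invertible a with a ≟ 0#
  ... | yes a≈0 = inj₁ a≈0
  ... | no a≉0  = inj₂ (inverse a a≉0)

  dot : ∀ {d} → (Fin d → Carrier) → (Fin d → Carrier) → Carrier
  dot {zero}  c s = 0#
  dot {suc d} c s = c Fin.zero * s Fin.zero + dot (tail c) (tail s)

  mem-lincomb : (S : Subspace) {d : ℕ} (c : Fin d → Carrier) (b : Fin d → V) →
                (∀ k → mem S (b k)) → mem S (lincomb c b)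
  mem-lincomb S {zero}  c b b∈S = mem-0 S
  mem-lincomb S {suc d} c b b∈S =
    mem-+ S (mem-· S (c Fin.zero) (b∈S Fin.zero)) (mem-lincomb S (tail c) (tail b) (b∈S ∘ Fin.suc))

  lincomb-zero : ∀ {d} (c : Fin d → Carrier) (b : Fin d → V) → (∀ k → c k ≈ 0#) → lincomb c b ≈ᵥ 0ᵥ
  lincomb-zero {zero}  c b c≈0 i = refl
  lincomb-zero {suc d} c b c≈0 i =
    trans (+-cong (*-annihilatedˡ _ (c≈0 Fin.zero)) (lincomb-zero (tail c) (tail b) (c≈0 ∘ Fin.suc) i))
          (+-identityˡ 0#)

  lincomb-+-· : ∀ {d} (c a : Fin d → Carrier) (s : Carrier) (b : Fin d → V) →
                lincomb (λ k → c k + s * a k) b ≈ᵥ (lincomb c b +ᵥ (s ·ᵥ lincomb a b))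
  lincomb-+-· {zero}  c a s b i = sym (trans (+-identityˡ _) (zeroʳ s))
  lincomb-+-· {suc d} c a s b i =
    trans (+-cong refl (lincomb-+-· (tail c) (tail a) s (tail b) i))
          (solve 6 (λ c₀ s a₀ b₀ C A → ((c₀ :+ s :* a₀) :* b₀) :+ (C :+ s :* A)
                                       := (c₀ :* b₀ :+ C) :+ s :* (a₀ :* b₀ :+ A))
                 refl (c Fin.zero) s (a Fin.zero) (b Fin.zero i)
                 (lincomb (tail c) (tail b) i) (lincomb (tail a) (tail b) i))

  lincomb-punchIn : ∀ {d} (p : Fin (suc d)) (c : Fin (suc d) → Carrier) (b : Fin (suc d) → V) →
                    c p ≈ 0# → lincomb c b ≈ᵥ lincomb (c ∘ Fin.punchIn p) (b ∘ Fin.punchIn p)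
  lincomb-punchIn Fin.zero c b c₀≈0 i = annihilated-+ _ _ c₀≈0
  lincomb-punchIn {suc d} (Fin.suc p) c b cₚ≈0 i =
    +-cong refl (lincomb-punchIn p (tail c) (tail b) cₚ≈0 i)

  lincomb-shift : ∀ {d} (c : Fin d → Carrier) (r : Fin d → V) (s : Fin d → Carrier) (x : V) →
                  lincomb c (λ k → r k +ᵥ (s k ·ᵥ x)) ≈ᵥ (lincomb c r +ᵥ (dot c s ·ᵥ x))
  lincomb-shift {zero}  c r s x i = sym (trans (+-identityˡ _) (zeroˡ _))
  lincomb-shift {suc d} c r s x i =
    trans (+-cong refl (lincomb-shift (tail c) (tail r) (tail s) x i))
          (solve 6 (λ c₀ r₀ s₀ x R S → c₀ :* (r₀ :+ s₀ :* x) :+ (R :+ S :* x)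
                                       := (c₀ :* r₀ :+ R) :+ (c₀ :* s₀ :+ S) :* x)
                 refl (c Fin.zero) (r Fin.zero i) (s Fin.zero) (x i)
                 (lincomb (tail c) (tail r) i) (dot (tail c) (tail s)))

  InSpan : ∀ {m} → (Fin m → V) → V → Set
  InSpan w v = ∃ λ c → v ≈ᵥ lincomb c w

  LinearlyDependent : ∀ {ℓ} → (Fin ℓ → V) → Set
  LinearlyDependent u = ∃ λ c → lincomb c u ≈ᵥ 0ᵥ × ∃ λ k → ¬ c k ≈ 0#

  zero-vector⇒dependent : ∀ {ℓ} (u : Fin (suc ℓ) → V) → u Fin.zero ≈ᵥ 0ᵥ → LinearlyDependent u
  zero-vector⇒dependent u u₀≈0 = (1# ∷ λ _ → 0#) , combination , Fin.zero , λ 1≈0 → 0≉1 (sym 1≈0)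
    where
      combination : lincomb (1# ∷ λ _ → 0#) u ≈ᵥ 0ᵥ
      combination i = trans (+-cong (trans (*-identityˡ _) (u₀≈0 i))
                                    (lincomb-zero (λ _ → 0#) (tail u) (λ _ → refl) i))
                            (+-identityˡ 0#)

  -- Steinitz: more than m vectors in the span of m vectors are dependent.  Induction on m:
  -- the pivot coefficient of u₀ is used to clear one spanning vector from all the other u_k.
  spannedByFewer⇒dependent : ∀ {m ℓ} → m < ℓ → (u : Fin ℓ → V) (w : Fin m → V) →
                             (∀ k → InSpan w (u k)) → LinearlyDependent u
  spannedByFewer⇒dependent {zero} {suc ℓ} _ u w u∈span = zero-vector⇒dependent u (proj₂ (u∈span Fin.zero))
  spannedByFewer⇒dependent {suc m} {suc ℓ} (s≤s m<ℓ) u w u∈span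
    with u∈span Fin.zero | FinP.any? (λ l → ¬? (proj₁ (u∈span Fin.zero) l ≟ 0#))
  ... | a , u₀≈ | no noPivot =
    zero-vector⇒dependent u (≈ᵥ.trans u₀≈ (lincomb-zero a w allZero))
    where
      allZero : ∀ l → a l ≈ 0#
      allZero l with a l ≟ 0#
      ... | yes aₗ≈0 = aₗ≈0
      ... | no aₗ≉0  = ⊥-elim (noPivot (l , aₗ≉0))
  ... | a , u₀≈ | yes (p , aₚ≉0) =
    (dot c s ∷ c) , combination , Fin.suc j , cⱼ≉0
    where
      α = proj₁ (inverse (a p) aₚ≉0)
      aₚα≈1 = proj₂ (inverse (a p) aₚ≉0)
      b : Fin ℓ → Fin (suc m) → Carrier
      b k = proj₁ (u∈span (Fin.suc k))
      s : Fin ℓ → Carrier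
      s k = (- b k p) * α
      r : Fin ℓ → V
      r k = u (Fin.suc k) +ᵥ (s k ·ᵥ u Fin.zero)
      e : Fin ℓ → Fin (suc m) → Carrier
      e k l = b k l + s k * a l
      eₚ≈0 : ∀ k → e k p ≈ 0#
      eₚ≈0 k = trans (+-cong refl sₖaₚ≈-bₖₚ) (-‿inverseʳ _)
        where
          sₖaₚ≈-bₖₚ : s k * a p ≈ - b k p
          sₖaₚ≈-bₖₚ = trans (solve 3 (λ β α a → (β :* α) :* a := β :* (a :* α)) refl (- b k p) α (a p))
                            (trans (*-cong refl aₚα≈1) (*-identityʳ _))
      r∈span : ∀ k → InSpan (w ∘ Fin.punchIn p) (r k)
      r∈span k = e k ∘ Fin.punchIn p , λ i →
        trans (+-cong (proj₂ (u∈span (Fin.suc k)) i) (*-cong refl (u₀≈ i)))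
              (trans (sym (lincomb-+-· (b k) a (s k) w i))
                     (lincomb-punchIn p (e k) w (eₚ≈0 k) i))
      IH = spannedByFewer⇒dependent m<ℓ r (w ∘ Fin.punchIn p) r∈span
      c = proj₁ IH
      j = proj₁ (proj₂ (proj₂ IH))
      cⱼ≉0 = proj₂ (proj₂ (proj₂ IH))
      combination : lincomb (dot c s ∷ c) u ≈ᵥ 0ᵥ
      combination i = trans (+-comm _ _)
                            (trans (sym (lincomb-shift c (tail u) s (u Fin.zero) i)) (proj₁ (proj₂ IH) i))

  isolate : ∀ γ g y T → γ * g ≈ 1# → γ * y + T ≈ 0# → y ≈ (- g) * T
  isolate γ g y T γg≈1 γy+T≈0 = begin
    y                                  ≈⟨ sym (*-identityˡ y) ⟩
    1# * y                             ≈⟨ *-cong (sym γg≈1) refl ⟩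
    (γ * g) * y                        ≈⟨ sym (+-identityʳ _) ⟩
    (γ * g) * y + 0#                   ≈⟨ +-cong refl (sym g+-g≈0) ⟩
    (γ * g) * y + (g + - g) * T        ≈⟨ solve 5 (λ γ g y T g′ → (γ :* g) :* y :+ (g :+ g′) :* T
                                                              := g :* (γ :* y :+ T) :+ g′ :* T)
                                                    refl γ g y T (- g) ⟩
    g * (γ * y + T) + (- g) * T        ≈⟨ +-cong (trans (*-cong refl γy+T≈0) (zeroʳ g)) refl ⟩
    0# + (- g) * T                     ≈⟨ +-identityˡ _ ⟩
    (- g) * T                          ∎
    where
      open import Relation.Binary.Reasoning.Setoid setoid
      g+-g≈0 : (g + - g) * T ≈ 0#
      g+-g≈0 = *-annihilatedˡ T (-‿inverseʳ g)

  -- The vectors v, x and a basis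
  -- of G are d + 2 vectors in the (d + 1)-dimensional A, hence dependent; the coefficient of v
  -- cannot vanish, since x ∉ G and the basis of G is independent.
  codimOne-decomposition : ∀ {A G d x} → HasDim A (suc d) → HasDim G d → G ⊆ A → mem A x → ¬ mem G x →
                           ∀ v → mem A v → ∃ λ a → ∃ λ w → mem G w × v ≈ᵥ ((a ·ᵥ x) +ᵥ w)
  codimOne-decomposition {A} {G} {d} {x} (basisA , _ , _ , spanA) (basisG , basisG∈G , independentG , _)
                         G⊆A x∈A x∉G v v∈A = decompose (zero-or-invertible γ) (zero-or-invertible β)
    where
      vectors∈span : ∀ k → InSpan basisA ((v ∷ x ∷ basisG) k)
      vectors∈span Fin.zero = spanA v v∈A
      vectors∈span (Fin.suc Fin.zero) = spanA x x∈A
      vectors∈span (Fin.suc (Fin.suc k)) = spanA (basisG k) (G⊆A _ (basisG∈G k))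
      dependent = spannedByFewer⇒dependent (ℕ.n<1+n (suc d)) (v ∷ x ∷ basisG) basisA vectors∈span
      c = proj₁ dependent
      dependence = proj₁ (proj₂ dependent)
      γ = c Fin.zero
      β = c (Fin.suc Fin.zero)
      L : V
      L = lincomb (tail (tail c)) basisG
      L∈G : ∀ a → mem G (a ·ᵥ L)
      L∈G a = mem-· G a (mem-lincomb G _ basisG basisG∈G)
      γ≈0⇒βx+L≈0 : γ ≈ 0# → ∀ i → β * x i + L i ≈ 0#
      γ≈0⇒βx+L≈0 γ≈0 i = trans (sym (annihilated-+ _ _ γ≈0)) (dependence i)
      decompose : γ ≈ 0# ⊎ ∃ (λ g → γ * g ≈ 1#) → β ≈ 0# ⊎ ∃ (λ g → β * g ≈ 1#) →
                  ∃ λ a → ∃ λ w → mem G w × v ≈ᵥ ((a ·ᵥ x) +ᵥ w)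
      decompose (inj₂ (g , γg≈1)) _ = (- g) * β , ((- g) ·ᵥ L) , L∈G (- g) , λ i →
        trans (isolate γ g (v i) _ γg≈1 (dependence i))
              (solve 4 (λ g β x L → g :* (β :* x :+ L) := (g :* β) :* x :+ g :* L) refl (- g) β (x i) (L i))
      decompose (inj₁ γ≈0) (inj₂ (g , βg≈1)) =
        ⊥-elim (x∉G (mem-resp G (λ i → sym (isolate β g (x i) _ βg≈1 (γ≈0⇒βx+L≈0 γ≈0 i))) (L∈G (- g))))
      decompose (inj₁ γ≈0) (inj₁ β≈0) = ⊥-elim (uncurry nonzero (proj₂ (proj₂ dependent)))
        where
          L≈0 : L ≈ᵥ 0ᵥ
          L≈0 i = trans (sym (annihilated-+ _ _ β≈0)) (γ≈0⇒βx+L≈0 γ≈0 i)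
          nonzero : ∀ k → ¬ c k ≈ 0# → ⊥
          nonzero Fin.zero = λ γ≉0 → γ≉0 γ≈0
          nonzero (Fin.suc Fin.zero) = λ β≉0 → β≉0 β≈0
          nonzero (Fin.suc (Fin.suc k)) = λ cₖ≉0 → cₖ≉0 (independentG _ L≈0 k)

  -- R F i j x unfolds to ComplementLine (F i) (F j) x.

  Decomposes : Subspace → Subspace → V → V → Set
  Decomposes A B x v = ∃ λ a → ∃ λ w → (mem A w × mem B w) × v ≈ᵥ ((a ·ᵥ x) +ᵥ w)

  ComplementLine : Subspace → Subspace → V → Set
  ComplementLine A B x =
      mem A x
    × (∀ v → (mem A v → Decomposes A B x v) × (Decomposes A B x v → mem A v))
    × (∀ a → (mem A (a ·ᵥ x) × mem B (a ·ᵥ x)) → (a ·ᵥ x) ≈ᵥ 0ᵥ)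

  decomposes-trans : ∀ {A B x y v} → Decomposes A B x y → Decomposes A B y v → Decomposes A B x v
  decomposes-trans {A} {B} (c , w′ , (w′∈A , w′∈B) , y≈) (a , w , (w∈A , w∈B) , v≈) =
    a * c , ((a ·ᵥ w′) +ᵥ w) , (mem-+ A (mem-· A a w′∈A) w∈A , mem-+ B (mem-· B a w′∈B) w∈B) , λ i →
      trans (v≈ i) (trans (+-cong (*-cong refl (y≈ i)) refl)
        (solve 5 (λ a c x w′ w → a :* (c :* x :+ w′) :+ w := (a :* c) :* x :+ (a :* w′ :+ w))
               refl a c _ (w′ i) (w i)))

  decomposes-flip : ∀ {A B x y b w′ α} → mem A w′ → mem B w′ → x ≈ᵥ ((b ·ᵥ y) +ᵥ w′) → b * α ≈ 1# →
                    Decomposes A B x y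
  decomposes-flip {A} {B} {x} {y} {b} {w′} {α} w′∈A w′∈B x≈ bα≈1 =
    α , ((- α) ·ᵥ w′) , (mem-· A (- α) w′∈A , mem-· B (- α) w′∈B) , λ i → sym (begin
      α * x i + (- α) * w′ i                   ≈⟨ +-cong (*-cong refl (x≈ i)) refl ⟩
      α * (b * y i + w′ i) + (- α) * w′ i      ≈⟨ solve 5 (λ α α′ b y w′ → α :* (b :* y :+ w′) :+ α′ :* w′
                                                                    := (b :* α) :* y :+ (α :+ α′) :* w′)
                                                        refl α (- α) b (y i) (w′ i) ⟩
      (b * α) * y i + (α + - α) * w′ i         ≈⟨ +-cong (trans (*-cong bα≈1 refl) (*-identityˡ _))
                                                         (*-annihilatedˡ _ (-‿inverseʳ α)) ⟩
      y i + 0#                                 ≈⟨ +-identityʳ _ ⟩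
      y i                                      ∎)
    where open import Relation.Binary.Reasoning.Setoid setoid

  scalar-∉ : ∀ B {x} a → ¬ mem B x → mem B (a ·ᵥ x) → a ≈ 0#
  scalar-∉ B {x} a x∉B ax∈B with zero-or-invertible a
  ... | inj₁ a≈0 = a≈0
  ... | inj₂ (α , aα≈1) = ⊥-elim (x∉B (mem-resp B α·ax≈x (mem-· B α ax∈B)))
    where
      α·ax≈x : (α ·ᵥ (a ·ᵥ x)) ≈ᵥ x
      α·ax≈x i = trans (solve 3 (λ α a x → α :* (a :* x) := (a :* α) :* x) refl α a (x i))
                       (trans (*-cong aα≈1 refl) (*-identityˡ (x i)))

  complementLine-intro : ∀ {A B x} → mem A x → ¬ mem B x → (∀ v → mem A v → Decomposes A B x v) →
                         ComplementLine A B x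
  complementLine-intro {A} {B} {x} x∈A x∉B decompose =
    x∈A , (λ v → decompose v , decomposed∈A v) ,
    λ a (_ , ax∈B) i → *-annihilatedˡ (x i) (scalar-∉ B a x∉B ax∈B)
    where
      decomposed∈A : ∀ v → Decomposes A B x v → mem A v
      decomposed∈A v (a , w , (w∈A , _) , v≈) = mem-resp A (≈ᵥ.sym v≈) (mem-+ A (mem-· A a x∈A) w∈A)

  complementLine-transfer : ∀ {A B y x} → ComplementLine A B y → mem A x → ¬ mem B x → ComplementLine A B x
  complementLine-transfer {A} {B} {y} {x} (_ , decomposition , _) x∈A x∉B =
    complementLine-intro {A} {B} x∈A x∉B λ v v∈A →
      decomposes-trans {A} {B} (y-along-x (proj₁ (decomposition x) x∈A)) (proj₁ (decomposition v) v∈A)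
    where
      y-along-x : Decomposes A B y x → Decomposes A B x y
      y-along-x (b , w′ , (w′∈A , w′∈B) , x≈) with zero-or-invertible b
      ... | inj₂ (α , bα≈1) = decomposes-flip {A} {B} w′∈A w′∈B x≈ bα≈1
      ... | inj₁ b≈0 = ⊥-elim (x∉B (mem-resp B (λ i → sym (trans (x≈ i) (annihilated-+ _ _ b≈0))) w′∈B))

  complementLine-codimOne : ∀ {A B G d x} → HasDim A (suc d) → HasDim G d → G ⊆ A → G ⊆ B →
                            mem A x → ¬ mem B x → ComplementLine A B x
  complementLine-codimOne {A} {B} {G} dimA dimG G⊆A G⊆B x∈A x∉B =
    complementLine-intro {A} {B} x∈A x∉B λ v v∈A →
      let (a , w , w∈G , v≈) = codimOne-decomposition {A} {G} dimA dimG G⊆A x∈A (x∉B ∘ G⊆B _) v v∈A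
      in a , w , (G⊆A w w∈G , G⊆B w w∈G) , v≈

  complementLine-∈⇒⊆ : ∀ {A B x} → ComplementLine A B x → mem B x → A ⊆ B
  complementLine-∈⇒⊆ {A} {B} (_ , decomposition , _) x∈B v v∈A =
    let (a , w , (_ , w∈B) , v≈) = proj₁ (decomposition v) v∈A
    in mem-resp B (≈ᵥ.sym v≈) (mem-+ B (mem-· B a x∈B) w∈B)

module FiniteSpace (K : FiniteField) (n : ℕ) where
  open FiniteField K
  open Space K n

  open LinearAlgebra K n using (≈ᵥ-setoid)

  open Membership ≈ᵥ-setoid using (lose)

  vectors : ∀ m → List (Fin m → Carrier)
  vectors zero    = [ (λ ()) ]
  vectors (suc m) = concat (map (λ i → map (enum i Vector.∷_) (vectors m)) (allFin q))

  vectors-complete : ∀ m (v : Fin m → Carrier) → Any (Pointwise _≈_ v) (vectors m)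
  vectors-complete zero    v = here (λ ())
  vectors-complete (suc m) v with enum-surj (v Fin.zero)
  ... | i , enumᵢ≈v₀ =
    Any.concat⁺ (Any.map⁺ (Any.tabulate⁺ i (Any.map⁺ (Any.map extend (vectors-complete m (tail v))))))
    where
      extend : ∀ {u} → Pointwise _≈_ (tail v) u → Pointwise _≈_ v (enum i Vector.∷ u)
      extend tail-v≈u Fin.zero    = sym enumᵢ≈v₀
      extend tail-v≈u (Fin.suc k) = tail-v≈u k

  ∃? : (P : V → Set) → (∀ v → Dec (P v)) → (∀ {u v} → u ≈ᵥ v → P u → P v) → Dec (∃ P)
  ∃? P P? resp = map′ satisfied (λ (v , Pv) → lose resp (vectors-complete n v) Pv) (any? P? (vectors n))

  _∖_ : Subspace → Subspace → V → Set
  (A ∖ B) x = mem A x × ¬ mem B x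

  ∖-resp : ∀ A B {u v} → u ≈ᵥ v → (A ∖ B) u → (A ∖ B) v
  ∖-resp A B u≈v (u∈A , u∉B) = mem-resp A u≈v u∈A , λ v∈B → u∉B (mem-resp B (λ i → sym (u≈v i)) v∈B)

  ⊆⊎⊈ : ∀ A B → A ⊆ B ⊎ ∃ (A ∖ B)
  ⊆⊎⊈ A B with ∃? (A ∖ B) (λ x → mem? A x ×-dec ¬? (mem? B x)) (∖-resp A B)
  ... | yes outside        = inj₂ outside
  ... | no nothing-outside =
    inj₁ λ v v∈A → decidable-stable (mem? B v) (λ v∉B → nothing-outside (v , v∈A , v∉B))

  _⊆?_ : ∀ A B → Dec (A ⊆ B)
  A ⊆? B with ⊆⊎⊈ A B
  ... | inj₁ A⊆B              = yes A⊆B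
  ... | inj₂ (x , x∈A , x∉B) = no λ A⊆B → x∉B (A⊆B x x∈A)

  card : Subspace → ℕ
  card A = length (filter (mem? A) (vectors n))

  card∁ : Subspace → ℕ
  card∁ A = length (vectors n) ∸ card A

  ⊂⇒card∁-< : ∀ {A B x} → A ⊆ B → (B ∖ A) x → card∁ B < card∁ A
  ⊂⇒card∁-< {A} {B} A⊆B x∈B∖A =
    ℕ.∸-monoʳ-< (length-filter-< (mem? A) (mem? B) (A⊆B _) (lose (∖-resp B A) (vectors-complete n _) x∈B∖A))
                (length-filter (mem? B) (vectors n))

  -- card∁ strictly decreases along strict inclusions, so ascending chains in Δ end in a facet.
  no-facet-above : (Δ : SubspSet) → ∀ A → Acc (_<_ on card∁) A → Δ A → (∀ G → IsFacet Δ G → ¬ A ⊆ G) → ⊥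
  no-facet-above Δ A (acc smaller) ΔA none = none A (ΔA , maximal) (λ _ v∈A → v∈A)
    where
      maximal : ∀ G → Δ G → A ⊆ G → G ⊆ A
      maximal G ΔG A⊆G with ⊆⊎⊈ G A
      ... | inj₁ G⊆A           = G⊆A
      ... | inj₂ (x , x∈G∖A) =
        ⊥-elim (no-facet-above Δ G (smaller (⊂⇒card∁-< {A} {G} A⊆G x∈G∖A)) ΔG
                               (λ H facetH G⊆H → none H facetH (λ v v∈A → G⊆H v (A⊆G v v∈A))))

  facet-above : (Δ : SubspSet) → ∀ {A} → Δ A → ¬ (∀ G → IsFacet Δ G → ¬ A ⊆ G)
  facet-above Δ {A} = no-facet-above Δ A (On.wellFounded card∁ <-wellFounded A)

module Shelling (K : FiniteField) (n : ℕ) (Δ : Space.SubspSet K n) {t : ℕ}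
                (F : Fin t → Space.Subspace K n) (order : Space.IsFacetOrder K n Δ F) where
  open Space K n
  open LinearAlgebra K n
  open FiniteSpace K n

  facets-⊆⇒≡ : ∀ i j → F i ⊆ F j → i ≡ j
  facets-⊆⇒≡ i j Fᵢ⊆Fⱼ =
    proj₂ (proj₂ order) i j Fᵢ⊆Fⱼ (proj₂ (proj₁ order i) (F j) (proj₁ (proj₁ order j)) Fᵢ⊆Fⱼ)

  Δ[_]? : ∀ m A → Dec (Δ[ F ] m A)
  Δ[ m ]? A = map′ lift lower (FinP.any? λ j → (toℕ j <? m) ×-dec (A ⊆? F j))

  Δ-mono : ∀ {l m} A → l ≤ m → Δ[ F ] l A → Δ[ F ] m A
  Δ-mono A l≤m (lift (j , j<l , A⊆Fⱼ)) = lift (j , ℕ.<-≤-trans j<l l≤m , A⊆Fⱼ)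

  Δ-suc : ∀ i A → Δ[ F ] (suc (toℕ i)) A ⇔ (A ⊆ F i ⊎ Δ[ F ] (toℕ i) A)
  Δ-suc i A = mk⇔ to from
    where
      to : Δ[ F ] (suc (toℕ i)) A → A ⊆ F i ⊎ Δ[ F ] (toℕ i) A
      to (lift (j , j<1+i , A⊆Fⱼ)) with ℕ.m≤n⇒m<n∨m≡n (ℕ.≤-pred j<1+i)
      ... | inj₁ j<i = inj₂ (lift (j , j<i , A⊆Fⱼ))
      ... | inj₂ j≡i with FinP.toℕ-injective j≡i
      ... | ≡.refl = inj₁ A⊆Fⱼ
      from : A ⊆ F i ⊎ Δ[ F ] (toℕ i) A → Δ[ F ] (suc (toℕ i)) A
      from (inj₁ A⊆Fᵢ) = lift (i , ℕ.n<1+n (toℕ i) , A⊆Fᵢ)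
      from (inj₂ A∈Δᵢ) = Δ-mono A (ℕ.n≤1+n (toℕ i)) A∈Δᵢ

  newFace⇒I : ∀ i A → A ⊆ F i → ¬ Δ[ F ] (toℕ i) A → I F i A
  newFace⇒I i A A⊆Fᵢ A∉Δᵢ = lift (A⊆Fᵢ , λ j j<i (y , y∈Rᵢⱼ) → lineIn j j<i y∈Rᵢⱼ)
    where
      lineIn : ∀ j → toℕ j < toℕ i → ∀ {y} → R F i j y → ∃ λ x → mem A x × R F i j x
      lineIn j j<i y∈Rᵢⱼ with ⊆⊎⊈ A (F j)
      ... | inj₁ A⊆Fⱼ = ⊥-elim (A∉Δᵢ (lift (j , j<i , A⊆Fⱼ)))
      ... | inj₂ (x , x∈A , x∉Fⱼ) =
        x , x∈A , complementLine-transfer {F i} {F j} y∈Rᵢⱼ (A⊆Fᵢ x x∈A) x∉Fⱼ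

  I∩Δ≡∅ : IsShelling F → ∀ i A → ¬ (I F i A × Δ[ F ] (toℕ i) A)
  I∩Δ≡∅ shelling i A (lift (A⊆Fᵢ , lineIn) , lift (j , j<i , A⊆Fⱼ))
    with shelling i (ℕ.≤-<-trans z≤n j<i)
  ... | 𝒢 , _ , (d , dimFᵢ , 𝒢-faces) , generates
    with proj₂ (generates A) (A⊆Fᵢ , lift (j , j<i , A⊆Fⱼ))
  ... | G , G∈𝒢 , A⊆G
    with 𝒢-faces G G∈𝒢 | proj₁ (generates G) (G , G∈𝒢 , λ _ v∈G → v∈G)
  ... | G⊆Fᵢ , dimG | _ , lift (k , k<i , G⊆Fₖ) =
    ℕ.<-irrefl (≡.cong toℕ (≡.sym (facets-⊆⇒≡ i k Fᵢ⊆Fₖ))) k<i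
    where
      Fᵢ⊆Fₖ : F i ⊆ F k
      Fᵢ⊆Fₖ with ⊆⊎⊈ (F i) (F k)
      ... | inj₁ Fᵢ⊆Fₖ = Fᵢ⊆Fₖ
      ... | inj₂ (x , x∈Fᵢ , x∉Fₖ) =
        let x∈Rᵢₖ = complementLine-codimOne {F i} {F k} {G} dimFᵢ dimG G⊆Fᵢ G⊆Fₖ x∈Fᵢ x∉Fₖ
            (x′ , x′∈A , x′∈Rᵢₖ) = lineIn k k<i (x , x∈Rᵢₖ)
        in complementLine-∈⇒⊆ {F i} {F k} x′∈Rᵢₖ (G⊆Fₖ x′ (A⊆G x′ x′∈A))

  Δ-step : IsShelling F → ∀ i A →
           (Δ[ F ] (suc (toℕ i)) A ⇔ (I F i A ⊎ Δ[ F ] (toℕ i) A)) × ¬ (I F i A × Δ[ F ] (toℕ i) A)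
  Δ-step shelling i A = mk⇔ to from , I∩Δ≡∅ shelling i A
    where
      to : Δ[ F ] (suc (toℕ i)) A → I F i A ⊎ Δ[ F ] (toℕ i) A
      to A∈Δᵢ₊₁ with Equivalence.to (Δ-suc i A) A∈Δᵢ₊₁ | Δ[ toℕ i ]? A
      ... | inj₂ A∈Δᵢ | _         = inj₂ A∈Δᵢ
      ... | inj₁ _    | yes A∈Δᵢ  = inj₂ A∈Δᵢ
      ... | inj₁ A⊆Fᵢ | no A∉Δᵢ   = inj₁ (newFace⇒I i A A⊆Fᵢ A∉Δᵢ)
      from : I F i A ⊎ Δ[ F ] (toℕ i) A → Δ[ F ] (suc (toℕ i)) A
      from (inj₁ (lift (A⊆Fᵢ , _))) = Equivalence.from (Δ-suc i A) (inj₁ A⊆Fᵢ)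
      from (inj₂ A∈Δᵢ)              = Equivalence.from (Δ-suc i A) (inj₂ A∈Δᵢ)

  Δ[]⇒I : ∀ m A → Δ[ F ] m A → ∃ λ i → I F i A
  Δ[]⇒I (suc m) A (lift (j , j<1+m , A⊆Fⱼ)) with Δ[ toℕ j ]? A
  ... | yes A∈Δⱼ = Δ[]⇒I m A (Δ-mono A (ℕ.≤-pred j<1+m) A∈Δⱼ)
  ... | no A∉Δⱼ  = j , newFace⇒I j A A⊆Fⱼ A∉Δⱼ

  Δ⇒I : ∀ A → Δ A → ∃ λ i → I F i A
  Δ⇒I A A∈Δ with FinP.any? (λ k → A ⊆? F k)
  ... | yes (k , A⊆Fₖ) = Δ[]⇒I t A (lift (k , FinP.toℕ<n k , A⊆Fₖ))
  ... | no A⊈F = ⊥-elim (facet-above Δ A∈Δ λ G facetG A⊆G →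
                   let (k , G⊆Fₖ , _) = proj₁ (proj₂ order) G facetG
                   in A⊈F (k , λ v v∈A → G⊆Fₖ v (A⊆G v v∈A)))

  I⇒Δ : IsQComplex Δ → ∀ i A → I F i A → Δ A
  I⇒Δ complex i A (lift (A⊆Fᵢ , _)) = complex A (F i) A⊆Fᵢ (proj₁ (proj₁ order i))

  I-unique : IsShelling F → ∀ A i j → I F i A → I F j A → i ≡ j
  I-unique shelling A i j A∈Iᵢ A∈Iⱼ with FinP.<-cmp i j
  ... | tri< i<j _ _ = ⊥-elim (I∩Δ≡∅ shelling j A (A∈Iⱼ , lift (i , i<j , proj₁ (lower A∈Iᵢ))))
  ... | tri≈ _ i≡j _ = i≡j
  ... | tri> _ _ j<i = ⊥-elim (I∩Δ≡∅ shelling i A (A∈Iᵢ , lift (j , j<i , proj₁ (lower A∈Iⱼ))))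

theorem5p10 : (K : FiniteField) (n : ℕ) → let open Space K n in
    (Δ : SubspSet) → IsQComplex Δ → (∀ A → Dec (Δ A)) → IsPure Δ →
    (t : ℕ) (F : Fin t → Subspace) → IsFacetOrder Δ F → IsShelling F →
      (∀ (i : Fin t) (A : Subspace) →
          (Δ[ F ] (suc (toℕ i)) A ⇔ (I F i A ⊎ Δ[ F ] (toℕ i) A))
        × ¬ (I F i A × Δ[ F ] (toℕ i) A))
    × (∀ (A : Subspace) →
          (Δ A ⇔ (∃ λ (i : Fin t) → I F i A))
        × (∀ (i j : Fin t) → I F i A → I F j A → i ≡ j))
theorem5p10 K n Δ complex _ _ t F order shelling =
  Δ-step shelling , λ A → mk⇔ (Δ⇒I A) (λ (i , A∈Iᵢ) → I⇒Δ complex i A A∈Iᵢ) , I-unique shelling A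
  where open Shelling K n Δ F order
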